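{- Let $\{c_k\}_{k\ge0}$ be any sequence of complex numbers and let $d_n=\sum_{k=0}^n\binom{n}{k}(-1)^{n-k}c_k$ for $n\ge0$ (equivalently $c_n=\sum_{k=0}^n\binom{n}{k}d_k$). Then for every non-negative integer $n$, $$\sum_{k=0}^n\binom{n}{k}(-1)^{k-1}F_kc_k=\sum_{m=0}^n\binom{n}{m}d_mF_{n-2m}.$$
   Context: $F_n$ are the Fibonacci numbers: $F_0=0$, $F_1=1$, $F_n=F_{n-1}+F_{n-2}$, extended to negative indices by the same recurrence (i.e. $F_{n-2}=F_n-F_{n-1}$), so that $F_{ -n}=(-1)^{n+1}F_n$ for $n\ge0$. -}

module Defs where

open import Level using (Level)
open import Data.Nat as ℕ using (ℕ; zero; suc; _∸_)
open import Data.Nat.Combinatorics using (_C_)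
open import Data.Integer as ℤ using (ℤ; +_; -[1+_])
open import Algebra.Bundles using (CommutativeRing)

fibℕ : ℕ → ℤ
fibℕ zero = + 0
fibℕ (suc zero) = + 1
fibℕ (suc (suc n)) = fibℕ (suc n) ℤ.+ fibℕ n

-- fibNeg n = F_{-n}, via the backward recurrence F_{m-2} = F_m - F_{m-1}
fibNeg : ℕ → ℤ
fibNeg zero = + 0
fibNeg (suc zero) = + 1
fibNeg (suc (suc n)) = fibNeg n ℤ.- fibNeg (suc n)

fib : ℤ → ℤ
fib (+ n) = fibℕ n
fib -[1+ n ] = fibNeg (suc n)

module RingDefs {c ℓ : Level} (R : CommutativeRing c ℓ) where
  open CommutativeRing R public

  _•_ : ℕ → Carrier → Carrier
  zero • x = 0#
  suc n • x = x + (n • x)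

  ⟦_⟧ : ℤ → Carrier
  ⟦ + n ⟧ = n • 1#
  ⟦ -[1+ n ] ⟧ = - (suc n • 1#)

  sgn : ℕ → Carrier
  sgn zero = 1#
  sgn (suc k) = - (sgn k)

  Σ[0≤k≤_] : ℕ → (ℕ → Carrier) → Carrier
  Σ[0≤k≤ zero ] f = f 0
  Σ[0≤k≤ suc n ] f = Σ[0≤k≤ n ] f + f (suc n)

  binomDiff : (ℕ → Carrier) → ℕ → Carrier
  binomDiff c n = Σ[0≤k≤ n ] (λ k → (n C k) • (sgn (n ∸ k) * c k))

-- Generalise F to any v : ℤ → R with v(z+1) = v(z) + v(z-1); then v ∘ pred is
-- another such sequence. By Pascal's rule both sides S(n, c, v) of
--   Σ_k C(n,k) v(-k) c_k = Σ_m C(n,m) d_m v(n-2m)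
-- satisfy S(n+1, c, v) = S(n, c, v) + S(n, c ∘ suc, v ∘ pred): on the right this
-- uses d_{m+1} = d'_m - d_m, d' being the transform of c ∘ suc, together with the
-- recurrence for v. Induction on n proves the identity for all such v, and
-- v = F, with F_{-k} = (-1)^{k+1} F_k, gives the theorem.
module Submission where

open import Defs
open import Level using (Level)
open import Function using (_∘_)
open import Data.Nat using (ℕ; zero; suc; _∸_; _≤_; z≤n)
import Data.Nat as Nat
open import Data.Nat.Properties using (*-suc; +-suc; +-∸-assoc; ≤-refl; m≤n⇒m≤1+n; n<1+n)
open import Data.Nat.Combinatorics using (_C_; nCk+nC[k+1]≡[n+1]C[k+1]; k>n⇒nCk≡0)
open import Data.Integer using (ℤ; +_; -[1+_])
import Data.Integer as Int
open import Data.Integer.Properties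
  using (suc-+; minus-suc; pred-suc; suc-pred; neg-suc; 1-[1+n]≡-n; [1+m]⊖[1+n]≡m⊖n)
open import Data.Integer.Tactic.RingSolver using (solve-∀)
open import Algebra.Bundles using (CommutativeRing)
import Relation.Binary.PropositionalEquality as ≡

fib-suc : ∀ z → fib (Int.suc z) ≡.≡ fib z Int.+ fib (Int.pred z)
fib-suc (+ zero) = ≡.refl
fib-suc (+ suc n) = ≡.refl
fib-suc -[1+ zero ] = ≡.refl
fib-suc -[1+ suc n ] = x≡y+[x-y] (fibNeg (suc n)) (fibNeg (suc (suc n)))
  where
  x≡y+[x-y] : ∀ x y → x ≡.≡ y Int.+ (x Int.- y)
  x≡y+[x-y] = solve-∀

+[1+n]-2m≡suc[n-2m] : ∀ n m → + suc n Int.- + (2 Nat.* m) ≡.≡ Int.suc (+ n Int.- + (2 Nat.* m))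
+[1+n]-2m≡suc[n-2m] n m = suc-+ n (Int.- + (2 Nat.* m))

+[1+n]-2[1+m]≡pred[n-2m] : ∀ n m →
  + suc n Int.- + (2 Nat.* suc m) ≡.≡ Int.pred (+ n Int.- + (2 Nat.* m))
+[1+n]-2[1+m]≡pred[n-2m] n m = begin
  + suc n Int.- + (2 Nat.* suc m)             ≡⟨ ≡.cong (λ t → + suc n Int.- + t) (*-suc 2 m) ⟩
  + suc n Int.- + suc (suc (2 Nat.* m))       ≡⟨ minus-suc (+ suc n) (suc (2 Nat.* m)) ⟩
  Int.pred (+ suc n Int.- + suc (2 Nat.* m))  ≡⟨ ≡.cong Int.pred (minus-suc (+ suc n) (2 Nat.* m)) ⟩
  Int.pred (Int.pred (+ suc n Int.- + (2 Nat.* m)))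
    ≡⟨ ≡.cong (Int.pred ∘ Int.pred) (+[1+n]-2m≡suc[n-2m] n m) ⟩
  Int.pred (Int.pred (Int.suc (+ n Int.- + (2 Nat.* m))))
    ≡⟨ ≡.cong Int.pred (pred-suc (+ n Int.- + (2 Nat.* m))) ⟩
  Int.pred (+ n Int.- + (2 Nat.* m))          ∎
  where open ≡.≡-Reasoning

module FibonacciBinomial {a ℓ : Level} (R : CommutativeRing a ℓ) where
  open RingDefs R hiding (zero)
  open import Algebra.Properties.Ring ring
    using (-0#≈0#; -‿involutive; -‿+-comm; -‿distribˡ-*; [y-z]x≈yx-zx; xyx⁻¹≈y)
  open import Algebra.Properties.CommutativeSemigroup +-commutativeSemigroup
    using (interchange; x∙yz≈xz∙y)
  open import Algebra.Definitions.RawMonoid +-rawMonoid using (_×_)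
  open import Algebra.Properties.CommutativeMonoid.Mult +-commutativeMonoid
    using (×-congʳ; ×-homo-+; ×-distrib-+)
  open import Relation.Binary.Reasoning.Setoid setoid

  •≡× : ∀ k x → k • x ≡.≡ k × x
  •≡× zero x = ≡.refl
  •≡× (suc k) x = ≡.cong (_+_ x) (•≡× k x)

  •-congʳ : ∀ k {x y} → x ≈ y → k • x ≈ k • y
  •-congʳ k {x} {y} x≈y rewrite •≡× k x | •≡× k y = ×-congʳ k x≈y

  •-homo-+ : ∀ m n x → (m Nat.+ n) • x ≈ m • x + n • x
  •-homo-+ m n x rewrite •≡× (m Nat.+ n) x | •≡× m x | •≡× n x = ×-homo-+ x m n

  •-distrib-+ : ∀ k x y → k • (x + y) ≈ k • x + k • y
  •-distrib-+ k x y rewrite •≡× k (x + y) | •≡× k x | •≡× k y = ×-distrib-+ x y k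

  •-neg : ∀ k x → k • (- x) ≈ - (k • x)
  •-neg zero x = sym -0#≈0#
  •-neg (suc k) x = trans (+-congˡ (•-neg k x)) (-‿+-comm x (k • x))

  ⟦⊖⟧ : ∀ m n → ⟦ m Int.⊖ n ⟧ ≈ m • 1# - n • 1#
  ⟦⊖⟧ m zero = sym (trans (+-congˡ -0#≈0#) (+-identityʳ (m • 1#)))
  ⟦⊖⟧ zero (suc n) = sym (+-identityˡ _)
  ⟦⊖⟧ (suc m) (suc n) rewrite [1+m]⊖[1+n]≡m⊖n m n =
    trans (⟦⊖⟧ m n) (sym ([x+y]-[x+z]≈y-z 1# (m • 1#) (n • 1#)))
    where
    [x+y]-[x+z]≈y-z : ∀ x y z → (x + y) - (x + z) ≈ y - z
    [x+y]-[x+z]≈y-z x y z = begin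
      (x + y) - (x + z)       ≈⟨ +-congˡ (-‿+-comm x z) ⟨
      (x + y) + (- x + - z)   ≈⟨ interchange x y (- x) (- z) ⟩
      (x - x) + (y - z)       ≈⟨ +-congʳ (-‿inverseʳ x) ⟩
      0# + (y - z)            ≈⟨ +-identityˡ (y - z) ⟩
      y - z                   ∎

  ⟦⟧-homo-+ : ∀ x y → ⟦ x Int.+ y ⟧ ≈ ⟦ x ⟧ + ⟦ y ⟧
  ⟦⟧-homo-+ (+ m) (+ n) = •-homo-+ m n 1#
  ⟦⟧-homo-+ (+ m) -[1+ n ] = ⟦⊖⟧ m (suc n)
  ⟦⟧-homo-+ -[1+ m ] (+ n) = trans (⟦⊖⟧ n (suc m)) (+-comm _ _)
  ⟦⟧-homo-+ -[1+ m ] -[1+ n ] = begin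
    - (suc (suc (m Nat.+ n)) • 1#)
      ≈⟨ -‿cong (reflexive (≡.cong (λ t → suc t • 1#) (≡.sym (+-suc m n)))) ⟩
    - ((suc m Nat.+ suc n) • 1#)       ≈⟨ -‿cong (•-homo-+ (suc m) (suc n) 1#) ⟩
    - (suc m • 1# + suc n • 1#)        ≈⟨ -‿+-comm _ _ ⟨
    - (suc m • 1#) + - (suc n • 1#)    ∎

  Σ-cong≤ : ∀ n {f g} → (∀ k → k ≤ n → f k ≈ g k) → Σ[0≤k≤ n ] f ≈ Σ[0≤k≤ n ] g
  Σ-cong≤ zero f≈g = f≈g 0 z≤n
  Σ-cong≤ (suc n) f≈g =
    +-cong (Σ-cong≤ n (λ k k≤n → f≈g k (m≤n⇒m≤1+n k≤n))) (f≈g (suc n) ≤-refl)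

  Σ-cong : ∀ n {f g} → (∀ k → f k ≈ g k) → Σ[0≤k≤ n ] f ≈ Σ[0≤k≤ n ] g
  Σ-cong n f≈g = Σ-cong≤ n (λ k _ → f≈g k)

  Σ-distrib-+ : ∀ n f g → Σ[0≤k≤ n ] (λ k → f k + g k) ≈ Σ[0≤k≤ n ] f + Σ[0≤k≤ n ] g
  Σ-distrib-+ zero f g = refl
  Σ-distrib-+ (suc n) f g =
    trans (+-congʳ (Σ-distrib-+ n f g)) (interchange _ _ (f (suc n)) (g (suc n)))

  Σ-neg : ∀ n f → Σ[0≤k≤ n ] (λ k → - f k) ≈ - Σ[0≤k≤ n ] f
  Σ-neg zero f = refl
  Σ-neg (suc n) f = trans (+-congʳ (Σ-neg n f)) (-‿+-comm _ (f (suc n)))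

  Σ-unfoldˡ : ∀ n f → Σ[0≤k≤ suc n ] f ≈ f 0 + Σ[0≤k≤ n ] (f ∘ suc)
  Σ-unfoldˡ zero f = refl
  Σ-unfoldˡ (suc n) f = trans (+-congʳ (Σ-unfoldˡ n f)) (+-assoc (f 0) _ (f (suc (suc n))))

  binomialSum : ℕ → (ℕ → Carrier) → Carrier
  binomialSum n f = Σ[0≤k≤ n ] (λ k → (n C k) • f k)

  binomialSum-cong≤ : ∀ n {f g} → (∀ k → k ≤ n → f k ≈ g k) →
                      binomialSum n f ≈ binomialSum n g
  binomialSum-cong≤ n f≈g = Σ-cong≤ n (λ k k≤n → •-congʳ (n C k) (f≈g k k≤n))

  binomialSum-cong : ∀ n {f g} → (∀ k → f k ≈ g k) → binomialSum n f ≈ binomialSum n g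
  binomialSum-cong n f≈g = binomialSum-cong≤ n (λ k _ → f≈g k)

  binomialSum-distrib-+ : ∀ n f g →
    binomialSum n (λ k → f k + g k) ≈ binomialSum n f + binomialSum n g
  binomialSum-distrib-+ n f g =
    trans (Σ-cong n (λ k → •-distrib-+ (n C k) (f k) (g k))) (Σ-distrib-+ n _ _)

  binomialSum-neg : ∀ n f → binomialSum n (λ k → - f k) ≈ - binomialSum n f
  binomialSum-neg n f = trans (Σ-cong n (λ k → •-neg (n C k) (f k))) (Σ-neg n _)

  binomialSum-suc : ∀ n f → binomialSum (suc n) f ≈ binomialSum n f + binomialSum n (f ∘ suc)
  binomialSum-suc n f = begin
    binomialSum (suc n) f                              ≈⟨ Σ-unfoldˡ n _ ⟩
    f₀ + Σ[0≤k≤ n ] (λ k → (suc n C suc k) • f (suc k)) ≈⟨ +-congˡ (Σ-cong n pascal) ⟩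
    f₀ + Σ[0≤k≤ n ] (λ k → (n C k) • f (suc k) + (n C suc k) • f (suc k))
                                                       ≈⟨ +-congˡ (Σ-distrib-+ n _ _) ⟩
    f₀ + (binomialSum n (f ∘ suc) + rest)              ≈⟨ x∙yz≈xz∙y f₀ _ rest ⟩
    (f₀ + rest) + binomialSum n (f ∘ suc)              ≈⟨ +-congʳ (Σ-unfoldˡ n _) ⟨
    Σ[0≤k≤ suc n ] (λ k → (n C k) • f k) + binomialSum n (f ∘ suc)
                                                       ≈⟨ +-congʳ (+-congˡ last≈0) ⟩
    (binomialSum n f + 0#) + binomialSum n (f ∘ suc)   ≈⟨ +-congʳ (+-identityʳ _) ⟩
    binomialSum n f + binomialSum n (f ∘ suc)          ∎
    where
    f₀ rest : Carrier
    f₀ = 1 • f 0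
    rest = Σ[0≤k≤ n ] (λ k → (n C suc k) • f (suc k))
    pascal : ∀ k → (suc n C suc k) • f (suc k) ≈ (n C k) • f (suc k) + (n C suc k) • f (suc k)
    pascal k = trans (reflexive (≡.cong (_• f (suc k)) (≡.sym (nCk+nC[k+1]≡[n+1]C[k+1] n k))))
                     (•-homo-+ (n C k) (n C suc k) (f (suc k)))
    last≈0 : (n C suc n) • f (suc n) ≈ 0#
    last≈0 = reflexive (≡.cong (_• f (suc n)) (k>n⇒nCk≡0 (n<1+n n)))

  binomDiff-suc : ∀ c m → binomDiff c (suc m) ≈ binomDiff (c ∘ suc) m - binomDiff c m
  binomDiff-suc c m = begin
    binomDiff c (suc m)                                  ≈⟨ binomialSum-suc m _ ⟩
    binomialSum m (λ k → sgn (suc m ∸ k) * c k) + binomDiff (c ∘ suc) m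
      ≈⟨ +-congʳ (binomialSum-cong≤ m sign-flip) ⟩
    binomialSum m (λ k → - (sgn (m ∸ k) * c k)) + binomDiff (c ∘ suc) m
      ≈⟨ +-congʳ (binomialSum-neg m _) ⟩
    - binomDiff c m + binomDiff (c ∘ suc) m              ≈⟨ +-comm _ _ ⟩
    binomDiff (c ∘ suc) m - binomDiff c m                ∎
    where
    sign-flip : ∀ k → k ≤ m → sgn (suc m ∸ k) * c k ≈ - (sgn (m ∸ k) * c k)
    sign-flip k k≤m = trans (reflexive (≡.cong (λ t → sgn t * c k) (+-∸-assoc 1 k≤m)))
                            (sym (-‿distribˡ-* _ _))

  IsFibonacci : (ℤ → Carrier) → Set ℓ
  IsFibonacci v = ∀ z → v (Int.suc z) ≈ v z + v (Int.pred z)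

  isFibonacci-∘pred : ∀ {v} → IsFibonacci v → IsFibonacci (v ∘ Int.pred)
  isFibonacci-∘pred {v} fib-v z = begin
    v (Int.pred (Int.suc z))                    ≡⟨ ≡.cong v (pred-suc z) ⟩
    v z                                         ≡⟨ ≡.cong v (suc-pred z) ⟨
    v (Int.suc (Int.pred z))                    ≈⟨ fib-v (Int.pred z) ⟩
    v (Int.pred z) + v (Int.pred (Int.pred z))  ∎

  ⟦fib⟧-isFibonacci : IsFibonacci (⟦_⟧ ∘ fib)
  ⟦fib⟧-isFibonacci z =
    trans (reflexive (≡.cong ⟦_⟧ (fib-suc z))) (⟦⟧-homo-+ (fib z) (fib (Int.pred z)))

  isFibonacci⇒reflect : ∀ {v} → IsFibonacci v → v (+ 0) ≈ 0# →
                        ∀ k → v (Int.- + k) ≈ - sgn k * v (+ k)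
  isFibonacci⇒reflect _ v0≈0 zero =
    trans v0≈0 (sym (trans (*-congˡ v0≈0) (zeroʳ _)))
  isFibonacci⇒reflect {v} fib-v v0≈0 (suc zero) = begin
    v -[1+ 0 ]                ≈⟨ +-identityˡ _ ⟨
    0# + v -[1+ 0 ]           ≈⟨ +-congʳ v0≈0 ⟨
    v (+ 0) + v -[1+ 0 ]      ≈⟨ fib-v (+ 0) ⟨
    v (+ 1)                   ≈⟨ *-identityˡ _ ⟨
    1# * v (+ 1)              ≈⟨ *-congʳ (-‿involutive 1#) ⟨
    - (- 1#) * v (+ 1)        ∎
  isFibonacci⇒reflect {v} fib-v v0≈0 (suc (suc k)) = begin
    v -[1+ suc k ]                        ≈⟨ xyx⁻¹≈y _ _ ⟨
    (v -[1+ k ] + v -[1+ suc k ]) - v -[1+ k ]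
      ≈⟨ +-congʳ (fib-v -[1+ k ]) ⟨
    v (Int.suc -[1+ k ]) - v -[1+ k ]       ≡⟨ ≡.cong (λ z → v z - v -[1+ k ]) (1-[1+n]≡-n k) ⟩
    v (Int.- + k) - v -[1+ k ]
      ≈⟨ +-cong (isFibonacci⇒reflect fib-v v0≈0 k)
                (-‿cong (isFibonacci⇒reflect fib-v v0≈0 (suc k))) ⟩
    - s * A - (- (- s) * B)               ≈⟨ +-congˡ (-‿cong (*-congʳ (-‿involutive s))) ⟩
    - s * A - (s * B)                     ≈⟨ +-congˡ (-‿distribˡ-* s B) ⟩
    - s * A + - s * B                     ≈⟨ distribˡ (- s) A B ⟨
    - s * (A + B)                         ≈⟨ *-congˡ (+-comm A B) ⟩
    - s * (B + A)                         ≈⟨ *-cong (-‿involutive (- s)) (fib-v (+ suc k)) ⟨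
    - (- (- s)) * v (+ suc (suc k))       ∎
    where
    s A B : Carrier
    s = sgn k
    A = v (+ k)
    B = v (+ suc k)

  binomialSum-fibonacci : ∀ {v} → IsFibonacci v → ∀ c n →
    binomialSum n (λ k → v (Int.- + k) * c k)
      ≈ binomialSum n (λ m → binomDiff c m * v (+ n Int.- + (2 Nat.* m)))
  binomialSum-fibonacci _ c zero =
    +-congʳ (trans (*-comm _ _) (*-congʳ (sym (trans (+-identityʳ _) (*-identityˡ _)))))
  binomialSum-fibonacci {v} fib-v c (suc n) = begin
    binomialSum (suc n) (λ k → v (Int.- + k) * c k)          ≈⟨ binomialSum-suc n _ ⟩
    binomialSum n (λ k → v (Int.- + k) * c k)
      + binomialSum n (λ k → v -[1+ k ] * c (suc k))
      ≈⟨ +-congˡ (binomialSum-cong n (λ k → *-congʳ (reflexive (≡.cong v (neg-suc k))))) ⟩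
    binomialSum n (λ k → v (Int.- + k) * c k)
      + binomialSum n (λ k → w (Int.- + k) * c (suc k))
      ≈⟨ +-cong (binomialSum-fibonacci fib-v c n)
                (binomialSum-fibonacci (isFibonacci-∘pred fib-v) (c ∘ suc) n) ⟩
    binomialSum n (λ m → d m * v (e m)) + binomialSum n (λ m → d′ m * w (e m))
      ≈⟨ binomialSum-distrib-+ n _ _ ⟨
    binomialSum n (λ m → d m * v (e m) + d′ m * w (e m))   ≈⟨ binomialSum-cong n adjacent ⟨
    binomialSum n (λ m → r m + r (suc m))                  ≈⟨ binomialSum-distrib-+ n r (r ∘ suc) ⟩
    binomialSum n r + binomialSum n (r ∘ suc)              ≈⟨ binomialSum-suc n r ⟨
    binomialSum (suc n) r                                  ∎
    where
    w : ℤ → Carrier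
    w = v ∘ Int.pred
    d d′ : ℕ → Carrier
    d = binomDiff c
    d′ = binomDiff (c ∘ suc)
    e : ℕ → ℤ
    e m = + n Int.- + (2 Nat.* m)
    r : ℕ → Carrier
    r m = d m * v (+ suc n Int.- + (2 Nat.* m))
    adjacent : ∀ m → r m + r (suc m) ≈ d m * v (e m) + d′ m * w (e m)
    adjacent m = begin
      r m + r (suc m)
        ≈⟨ +-cong (*-congˡ (reflexive (≡.cong v (+[1+n]-2m≡suc[n-2m] n m))))
                  (*-cong (binomDiff-suc c m) (reflexive (≡.cong v (+[1+n]-2[1+m]≡pred[n-2m] n m)))) ⟩
      d m * v (Int.suc (e m)) + (d′ m - d m) * w (e m)      ≈⟨ +-congʳ (*-congˡ (fib-v (e m))) ⟩
      d m * (v (e m) + w (e m)) + (d′ m - d m) * w (e m)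
        ≈⟨ +-cong (distribˡ (d m) _ _) ([y-z]x≈yx-zx (w (e m)) (d′ m) (d m)) ⟩
      (d m * v (e m) + d m * w (e m)) + (d′ m * w (e m) - d m * w (e m)) ≈⟨ +-assoc _ _ _ ⟩
      d m * v (e m) + (d m * w (e m) + (d′ m * w (e m) - d m * w (e m)))
        ≈⟨ +-congˡ (trans (sym (+-assoc _ _ _)) (xyx⁻¹≈y _ _)) ⟩
      d m * v (e m) + d′ m * w (e m)                      ∎

corollary4 : {a ℓ : Level} (R : CommutativeRing a ℓ) →
    let open RingDefs R in
    (c : ℕ → Carrier) (n : ℕ) →
    Σ[0≤k≤ n ] (λ k → (n C k) • ((- sgn k) * (⟦ fib (+ k) ⟧ * c k)))
      ≈ Σ[0≤k≤ n ] (λ m → (n C m) • (binomDiff c m * ⟦ fib (+ n Int.- + (2 Nat.* m)) ⟧))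
corollary4 R c n = begin
  binomialSum n (λ k → - sgn k * (⟦ fib (+ k) ⟧ * c k))     ≈⟨ binomialSum-cong n sign-absorbed ⟩
  binomialSum n (λ k → ⟦ fib (Int.- + k) ⟧ * c k)           ≈⟨ binomialSum-fibonacci ⟦fib⟧-isFibonacci c n ⟩
  binomialSum n (λ m → binomDiff c m * ⟦ fib (+ n Int.- + (2 Nat.* m)) ⟧) ∎
  where
  open RingDefs R
  open FibonacciBinomial R
  open import Relation.Binary.Reasoning.Setoid setoid
  sign-absorbed : ∀ k → - sgn k * (⟦ fib (+ k) ⟧ * c k) ≈ ⟦ fib (Int.- + k) ⟧ * c k
  sign-absorbed k = trans (sym (*-assoc _ _ _))
                          (*-congʳ (sym (isFibonacci⇒reflect ⟦fib⟧-isFibonacci refl k)))
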